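{- Consider an instance of Multistage Knapsack with $T$ time steps and its linear relaxation (LP-MK). Let $\hat S=(\hat x,\hat z)$ be a feasible solution of (LP-MK) with $\hat z_{ti}=1-|\hat x_{(t+1)i}-\hat x_{ti}|$ for all $t\le T-1$, $i\in N$, and let $1\le t_0\le t_1\le T$. Let $F(t_0,t_1)$ be the set of objects $i$ such that $0<\hat x_{t_0i}=\hat x_{(t_0+1)i}=\dots=\hat x_{t_1i}<1$, either $t_0=1$ or $\hat x_{(t_0-1)i}\neq\hat x_{t_0i}$, and either $t_1=T$ or $\hat x_{(t_1+1)i}\ne\hat x_{t_1i}$. For $t_0\le t\le t_1$ let $C'_t=C_t-\sum_{i\notin F(t_0,t_1)}w_{ti}\hat x_{ti}$. For $i\in F(t_0,t_1)$ define $a_i$ as follows: start with $a_i=0$; if $t_0>1$ and $\hat x_{(t_0-1)i}<\hat x_{t_0i}$ set $a_i=\hat x_{(t_0-1)i}$; then if $t_1<T$ and $\hat x_{(t_1+1)i}<\hat x_{t_1i}$ set $a_i=\max(a_i,\hat x_{(t_1+1)i})$. Similarly define $b_i$: start with $b_i=1$; if $t_0>1$ and $\hat x_{(t_0-1)i}>\hat x_{t_0i}$ set $b_i=\hat x_{(t_0-1)i}$; then if $t_1<T$ and $\hat x_{(t_1+1)i}>\hat x_{t_1i}$ set $b_i=\min(b_i,\hat x_{(t_1+1)i})$. Let $P(t_0,t_1)$ be the polyhedron of vectors $y=(y_i)_{i\in F(t_0,t_1)}$ satisfying $\sum_{i\in F(t_0,t_1)}w_{ti}y_i\le C'_t$ for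 all $t\in\{t_0,\dots,t_1\}$ and $a_i\le y_i\le b_i$ for all $i\in F(t_0,t_1)$. Let $\hat y$ be defined by $\hat y_i=\hat x_{t_0i}$ for $i\in F(t_0,t_1)$. If $\hat S$ is a basic solution of (LP-MK), then $\hat y$ is a feasible point of $P(t_0,t_1)$ and is a basic solution (vertex) of $P(t_0,t_1)$.
   Context: Multistage Knapsack: given a time horizon $T\ge 1$, objects $N=\{1,\dots,n\}$, for each $t\in\{1,\dots,T\}$ and $i\in N$ a profit $p_{ti}$ and a weight $w_{ti}$, for each $t\in\{1,\dots,T-1\}$ and $i\in N$ a bonus $B_{ti}\ge 0$, and capacities $C_t$. (LP-MK) is the linear program with variables $x_{ti}\in[0,1]$ ($t=1,\dots,T$, $i\in N$) and $z_{ti}\in[0,1]$ ($t=1,\dots,T-1$, $i\in N$): maximize $\sum_{t=1}^T\sum_{i\in N}p_{ti}x_{ti}+\sum_{t=1}^{T-1}\sum_{i\in N}B_{ti}z_{ti}$ subject to $\sum_{i\in N}w_{ti}x_{ti}\le C_t$ for all $t$, $z_{ti}\le -x_{(t+1)i}+x_{ti}+1$ and $z_{ti}\le x_{(t+1)i}-x_{ti}+1$ for all $t\le T-1$, $i\in N$. A basic solution of a polyhedron is a vertex (extreme point), i.e. a feasible point that is not the midpoint of two distinct feasible points.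
   Formalization: The profits, weights, bonuses and capacities, the variables x and z, the vectors y, and the points tested in both basic-solution conditions are rational rather than real. -}

module Defs where

open import Data.Nat as ℕ using (ℕ; zero; suc; _∸_)
import Data.Nat.Properties as ℕP
open import Data.Fin using (Fin; toℕ) renaming (zero to fzero; suc to fsuc)
open import Data.Fin.Properties using (all?)
open import Data.Rational using (ℚ; 0ℚ; 1ℚ; ½; _+_; _*_; _-_; -_; ∣_∣; _≤_; _<_; _⊔_; _⊓_)
open import Data.Rational.Properties using (_≟_; _≤?_; _<?_)
open import Data.Bool using (Bool; true; false; if_then_else_; _∧_)
open import Data.Product using (_×_; _,_)
open import Data.Sum using (_⊎_)
open import Relation.Nullary using (Dec; does; ¬_; ¬?; _×-dec_; _⊎-dec_)
open import Relation.Binary.PropositionalEquality using (_≡_; _≢_)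

sumFin : ∀ {n} → (Fin n → ℚ) → ℚ
sumFin {zero}  f = 0ℚ
sumFin {suc n} f = f fzero + sumFin {n} (λ i → f (fsuc i))

-- An instance of Multistage Knapsack. Time steps are the naturals 1..T;
-- data indexed by times outside the relevant range is ignored.
record MKInstance : Set where
  field
    T    : ℕ
    T≥1  : 1 ℕ.≤ T
    n    : ℕ
    p    : ℕ → Fin n → ℚ
    w    : ℕ → Fin n → ℚ
    B    : ℕ → Fin n → ℚ      -- B t i, used for 1 ≤ t ≤ T-1
    C    : ℕ → ℚ
    B≥0  : ∀ t i → 1 ℕ.≤ t → t ℕ.< T → 0ℚ ≤ B t i

module _ (I : MKInstance) where
  open MKInstance I

  FeasibleLP : (x z : ℕ → Fin n → ℚ) → Set
  FeasibleLP x z =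
      (∀ t i → 1 ℕ.≤ t → t ℕ.≤ T → 0ℚ ≤ x t i × x t i ≤ 1ℚ)
    × (∀ t i → 1 ℕ.≤ t → t ℕ.< T → 0ℚ ≤ z t i × z t i ≤ 1ℚ)
    × (∀ t → 1 ℕ.≤ t → t ℕ.≤ T → sumFin (λ i → w t i * x t i) ≤ C t)
    × (∀ t i → 1 ℕ.≤ t → t ℕ.< T → z t i ≤ (- x (suc t) i) + x t i + 1ℚ)
    × (∀ t i → 1 ℕ.≤ t → t ℕ.< T → z t i ≤ x (suc t) i - x t i + 1ℚ)

  SameSol : (x z x' z' : ℕ → Fin n → ℚ) → Set
  SameSol x z x' z' =
      (∀ t i → 1 ℕ.≤ t → t ℕ.≤ T → x t i ≡ x' t i)
    × (∀ t i → 1 ℕ.≤ t → t ℕ.< T → z t i ≡ z' t i)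

  IsMidpoint : (x z x₁ z₁ x₂ z₂ : ℕ → Fin n → ℚ) → Set
  IsMidpoint x z x₁ z₁ x₂ z₂ =
      (∀ t i → 1 ℕ.≤ t → t ℕ.≤ T → x t i ≡ ½ * (x₁ t i + x₂ t i))
    × (∀ t i → 1 ℕ.≤ t → t ℕ.< T → z t i ≡ ½ * (z₁ t i + z₂ t i))

  BasicLP : (x z : ℕ → Fin n → ℚ) → Set
  BasicLP x z = FeasibleLP x z
    × (∀ x₁ z₁ x₂ z₂ → FeasibleLP x₁ z₁ → FeasibleLP x₂ z₂ →
         IsMidpoint x z x₁ z₁ x₂ z₂ → SameSol x₁ z₁ x₂ z₂)

  module Sub (x : ℕ → Fin n → ℚ) (t₀ t₁ : ℕ) where

    ConstOn : Fin n → Set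
    ConstOn i = ∀ (k : Fin (suc (t₁ ∸ t₀))) → x (t₀ ℕ.+ toℕ k) i ≡ x t₀ i

    InF : Fin n → Set
    InF i = (0ℚ < x t₀ i × x t₀ i < 1ℚ)
          × ConstOn i
          × (t₀ ≡ 1 ⊎ x (t₀ ∸ 1) i ≢ x t₀ i)
          × (t₁ ≡ T ⊎ x (suc t₁) i ≢ x t₁ i)

    inF? : ∀ i → Dec (InF i)
    inF? i = ((0ℚ <? x t₀ i) ×-dec (x t₀ i <? 1ℚ))
        ×-dec all? (λ k → x (t₀ ℕ.+ toℕ k) i ≟ x t₀ i)
        ×-dec (t₀ ℕ.≟ 1 ⊎-dec ¬? (x (t₀ ∸ 1) i ≟ x t₀ i))
        ×-dec (t₁ ℕ.≟ T ⊎-dec ¬? (x (suc t₁) i ≟ x t₁ i))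

    C′ : ℕ → ℚ
    C′ t = C t - sumFin (λ i → if does (inF? i) then 0ℚ else w t i * x t i)

    a : Fin n → ℚ
    a i =
      let a₀ = if does (1 ℕ.<? t₀) ∧ does (x (t₀ ∸ 1) i <? x t₀ i)
                 then x (t₀ ∸ 1) i else 0ℚ
      in if does (t₁ ℕ.<? T) ∧ does (x (suc t₁) i <? x t₁ i)
           then a₀ ⊔ x (suc t₁) i else a₀

    b : Fin n → ℚ
    b i =
      let b₀ = if does (1 ℕ.<? t₀) ∧ does (x t₀ i <? x (t₀ ∸ 1) i)
                 then x (t₀ ∸ 1) i else 1ℚ
      in if does (t₁ ℕ.<? T) ∧ does (x t₁ i <? x (suc t₁) i)
           then b₀ ⊓ x (suc t₁) i else b₀

    -- y ∈ P(t₀,t₁); y is a vector indexed by F(t₀,t₁), represented as a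
    -- function on N whose values outside F are ignored
    InP : (Fin n → ℚ) → Set
    InP y =
        (∀ t → t₀ ℕ.≤ t → t ℕ.≤ t₁ →
           sumFin (λ i → if does (inF? i) then w t i * y i else 0ℚ) ≤ C′ t)
      × (∀ i → InF i → a i ≤ y i × y i ≤ b i)

    VertexP : (Fin n → ℚ) → Set
    VertexP y = InP y
      × (∀ y₁ y₂ → InP y₁ → InP y₂ →
           (∀ i → InF i → y i ≡ ½ * (y₁ i + y₂ i)) →
           ∀ i → InF i → y₁ i ≡ y₂ i)

    ŷ : Fin n → ℚ
    ŷ i = x t₀ i

{-# OPTIONS --safe #-}
module Submission where

-- Let y₁, y₂ ∈ P(t₀,t₁) have midpoint ŷ. Lift each back to (LP-MK) by putting y_i in place
-- of x_{ti} for t₀ ≤ t ≤ t₁ and i ∈ F(t₀,t₁), keeping x elsewhere, with z = 1 − |Δx|. The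
-- lifts are feasible, since [a,b] ⊆ [0,1] and C′ is C minus the load of the objects outside F.
-- Their midpoint is x, and it is also z: the bounds a and b put y₁ and y₂ on the same side of
-- x_{(t₀−1)i} and of x_{(t₁+1)i} as x_{t₀i}, so corresponding steps Δx of the two lifts have
-- the same sign, and on such pairs |·| is affine. As (x,z) is basic the lifts coincide, which
-- at time t₀ says y₁ = y₂.

open import Defs
open import Data.Nat as ℕ using (ℕ; suc; s≤s; z≤n; _∸_)
import Data.Nat.Properties as ℕₚ
open import Data.Fin using (Fin; toℕ; fromℕ<) renaming (zero to fzero; suc to fsuc)
open import Data.Fin.Properties using (toℕ-fromℕ<)
open import Data.Rational using (ℚ; 0ℚ; 1ℚ; ½; _+_; _*_; _-_; -_; ∣_∣)
open import Data.Bool using (if_then_else_)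
open import Data.Product using (_×_; _,_; proj₁; proj₂)
open import Data.Sum using (_⊎_; inj₁; inj₂)
open import Function using (_∘_)
open import Relation.Nullary using (Dec; yes; no; does; ¬_; _×-dec_; contradiction)
open import Relation.Nullary.Decidable using (dec-true; dec-false)
open import Relation.Binary using (tri<; tri≈; tri>)
open import Relation.Binary.PropositionalEquality

-- The order on ℚ is opened only in this block: in the statement below, _≤_ and _<_ are on ℕ.
module _ where
  open import Data.Rational using (_≤_; _<_)
  open import Data.Rational.Properties
  open import Data.Rational.Solver using (module +-*-Solver)
  open +-*-Solver
  open ≤-Reasoning

  p≤q⇒0≤q-p : ∀ {p q} → p ≤ q → 0ℚ ≤ q - p
  p≤q⇒0≤q-p {p} {q} p≤q = begin
    0ℚ    ≡⟨ +-inverseʳ p ⟨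
    p - p ≤⟨ +-monoˡ-≤ (- p) p≤q ⟩
    q - p ∎

  p≤q⇒p-q≤0 : ∀ {p q} → p ≤ q → p - q ≤ 0ℚ
  p≤q⇒p-q≤0 {p} {q} p≤q = begin
    p - q ≤⟨ +-monoˡ-≤ (- q) p≤q ⟩
    q - q ≡⟨ +-inverseʳ q ⟩
    0ℚ    ∎

  0≤q⇒p-q≤p : ∀ {p q} → 0ℚ ≤ q → p - q ≤ p
  0≤q⇒p-q≤p {p} {q} 0≤q = begin
    p - q  ≤⟨ +-monoʳ-≤ p (neg-antimono-≤ 0≤q) ⟩
    p + 0ℚ ≡⟨ +-identityʳ p ⟩
    p      ∎

  p+r≤q⇒p≤q-r : ∀ {p q r} → p + r ≤ q → p ≤ q - r
  p+r≤q⇒p≤q-r {p} {q} {r} p+r≤q = begin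
    p         ≡⟨ solve 2 (λ p r → p :+ r :- r := p) refl p r ⟨
    p + r - r ≤⟨ +-monoˡ-≤ (- r) p+r≤q ⟩
    q - r     ∎

  p≤q-r⇒p+r≤q : ∀ {p q r} → p ≤ q - r → p + r ≤ q
  p≤q-r⇒p+r≤q {p} {q} {r} p≤q-r = begin
    p + r     ≤⟨ +-monoˡ-≤ r p≤q-r ⟩
    q - r + r ≡⟨ solve 2 (λ q r → q :- r :+ r := q) refl q r ⟩
    q         ∎

  p≤∣p∣ : ∀ p → p ≤ ∣ p ∣
  p≤∣p∣ p with ≤-total 0ℚ p
  ... | inj₁ 0≤p = ≤-reflexive (sym (0≤p⇒∣p∣≡p 0≤p))
  ... | inj₂ p≤0 = ≤-trans p≤0 (0≤∣p∣ p)

  1-∣p∣≤1-p : ∀ p → 1ℚ - ∣ p ∣ ≤ 1ℚ - p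
  1-∣p∣≤1-p p = +-monoʳ-≤ 1ℚ (neg-antimono-≤ (p≤∣p∣ p))

  1-∣p∣≤1 : ∀ p → 1ℚ - ∣ p ∣ ≤ 1ℚ
  1-∣p∣≤1 p = +-monoʳ-≤ 1ℚ (neg-antimono-≤ (0≤∣p∣ p))

  InUnitInterval : ℚ → Set
  InUnitInterval p = 0ℚ ≤ p × p ≤ 1ℚ

  ∣p-q∣≤1 : ∀ {p q} → InUnitInterval p → InUnitInterval q → ∣ p - q ∣ ≤ 1ℚ
  ∣p-q∣≤1 {p} {q} (_ , p≤1) (0≤q , _) with ∣p∣≡p∨∣p∣≡-p (p - q)
  ... | inj₁ ∣p-q∣≡p-q = begin
    ∣ p - q ∣ ≡⟨ ∣p-q∣≡p-q ⟩
    p - q     ≤⟨ 0≤q⇒p-q≤p 0≤q ⟩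
    p         ≤⟨ p≤1 ⟩
    1ℚ        ∎
  ∣p-q∣≤1 {p} {q} (0≤p , _) (_ , q≤1) | inj₂ ∣p-q∣≡q-p = begin
    ∣ p - q ∣ ≡⟨ ∣p-q∣≡q-p ⟩
    - (p - q) ≡⟨ solve 2 (λ p q → :- (p :- q) := q :- p) refl p q ⟩
    q - p     ≤⟨ 0≤q⇒p-q≤p 0≤p ⟩
    q         ≤⟨ q≤1 ⟩
    1ℚ        ∎

  SameSide : ℚ → ℚ → ℚ → Set
  SameSide c u v = (c ≤ u × c ≤ v) ⊎ (u ≤ c × v ≤ c)

  sameSide-refl : ∀ c u → SameSide c u u
  sameSide-refl c u with ≤-total c u
  ... | inj₁ c≤u = inj₁ (c≤u , c≤u)
  ... | inj₂ u≤c = inj₂ (u≤c , u≤c)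

  sameSide-subʳ : ∀ {c u v} → SameSide c u v → SameSide 0ℚ (u - c) (v - c)
  sameSide-subʳ (inj₁ (c≤u , c≤v)) = inj₁ (p≤q⇒0≤q-p c≤u , p≤q⇒0≤q-p c≤v)
  sameSide-subʳ (inj₂ (u≤c , v≤c)) = inj₂ (p≤q⇒p-q≤0 u≤c , p≤q⇒p-q≤0 v≤c)

  sameSide-subˡ : ∀ {c u v} → SameSide c u v → SameSide 0ℚ (c - u) (c - v)
  sameSide-subˡ (inj₁ (c≤u , c≤v)) = inj₂ (p≤q⇒p-q≤0 c≤u , p≤q⇒p-q≤0 c≤v)
  sameSide-subˡ (inj₂ (u≤c , v≤c)) = inj₁ (p≤q⇒0≤q-p u≤c , p≤q⇒0≤q-p v≤c)

  OnSideOf : ℚ → ℚ → ℚ → Set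
  OnSideOf X c u = (c < X → c ≤ u) × (X < c → u ≤ c)

  onSideOf⇒sameSide : ∀ {X c u v} → c ≢ X → OnSideOf X c u → OnSideOf X c v → SameSide c u v
  onSideOf⇒sameSide {X} {c} c≢X (c≤u , u≤c) (c≤v , v≤c) with <-cmp c X
  ... | tri< c<X _ _ = inj₁ (c≤u c<X , c≤v c<X)
  ... | tri≈ _ c≡X _ = contradiction c≡X c≢X
  ... | tri> _ _ X<c = inj₂ (u≤c X<c , v≤c X<c)

  ½*[p+p]≡p : ∀ p → ½ * (p + p) ≡ p
  ½*[p+p]≡p = solve 1 (λ p → con ½ :* (p :+ p) := p) refl

  ∣½*[p+q]∣≡½*[∣p∣+∣q∣] : ∀ {p q} → SameSide 0ℚ p q → ∣ ½ * (p + q) ∣ ≡ ½ * (∣ p ∣ + ∣ q ∣)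
  ∣½*[p+q]∣≡½*[∣p∣+∣q∣] {p} {q} (inj₁ (0≤p , 0≤q)) = begin-equality
    ∣ ½ * (p + q) ∣     ≡⟨ 0≤p⇒∣p∣≡p (*-monoˡ-≤-nonNeg ½ (+-mono-≤ 0≤p 0≤q)) ⟩
    ½ * (p + q)         ≡⟨ cong₂ (λ r s → ½ * (r + s)) (0≤p⇒∣p∣≡p 0≤p) (0≤p⇒∣p∣≡p 0≤q) ⟨
    ½ * (∣ p ∣ + ∣ q ∣) ∎
  ∣½*[p+q]∣≡½*[∣p∣+∣q∣] {p} {q} (inj₂ (p≤0 , q≤0)) = begin-equality
    ∣ ½ * (p + q) ∣           ≡⟨ ∣-p∣≡∣p∣ (½ * (p + q)) ⟨
    ∣ - (½ * (p + q)) ∣       ≡⟨ cong ∣_∣ (solve 2 (λ p q → :- (con ½ :* (p :+ q)) := con ½ :* (:- p :+ :- q))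
                                                   refl p q) ⟩
    ∣ ½ * (- p + - q) ∣       ≡⟨ ∣½*[p+q]∣≡½*[∣p∣+∣q∣] (inj₁ (neg-antimono-≤ p≤0 , neg-antimono-≤ q≤0)) ⟩
    ½ * (∣ - p ∣ + ∣ - q ∣)   ≡⟨ cong₂ (λ r s → ½ * (r + s)) (∣-p∣≡∣p∣ p) (∣-p∣≡∣p∣ q) ⟩
    ½ * (∣ p ∣ + ∣ q ∣)       ∎

  1-∣v-u∣-midpoint : ∀ {u u₁ u₂ v v₁ v₂} → u ≡ ½ * (u₁ + u₂) → v ≡ ½ * (v₁ + v₂) →
    SameSide 0ℚ (v₁ - u₁) (v₂ - u₂) →
    1ℚ - ∣ v - u ∣ ≡ ½ * ((1ℚ - ∣ v₁ - u₁ ∣) + (1ℚ - ∣ v₂ - u₂ ∣))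
  1-∣v-u∣-midpoint {_} {u₁} {u₂} {_} {v₁} {v₂} refl refl same-sign = begin-equality
    1ℚ - ∣ ½ * (v₁ + v₂) - ½ * (u₁ + u₂) ∣ ≡⟨ cong (λ d → 1ℚ - ∣ d ∣) step-of-midpoints ⟩
    1ℚ - ∣ ½ * (d₁ + d₂) ∣                 ≡⟨ cong (_-_ 1ℚ) (∣½*[p+q]∣≡½*[∣p∣+∣q∣] same-sign) ⟩
    1ℚ - ½ * (∣ d₁ ∣ + ∣ d₂ ∣)             ≡⟨ 1-½*[p+q] ∣ d₁ ∣ ∣ d₂ ∣ ⟩
    ½ * ((1ℚ - ∣ d₁ ∣) + (1ℚ - ∣ d₂ ∣))    ∎
    where
    d₁ d₂ : ℚ
    d₁ = v₁ - u₁
    d₂ = v₂ - u₂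

    step-of-midpoints : ½ * (v₁ + v₂) - ½ * (u₁ + u₂) ≡ ½ * (d₁ + d₂)
    step-of-midpoints = solve 4 (λ u₁ u₂ v₁ v₂ →
      con ½ :* (v₁ :+ v₂) :- con ½ :* (u₁ :+ u₂) := con ½ :* ((v₁ :- u₁) :+ (v₂ :- u₂))) refl u₁ u₂ v₁ v₂

    1-½*[p+q] : ∀ p q → 1ℚ - ½ * (p + q) ≡ ½ * ((1ℚ - p) + (1ℚ - q))
    1-½*[p+q] = solve 2 (λ p q → con 1ℚ :- con ½ :* (p :+ q) := con ½ :* ((con 1ℚ :- p) :+ (con 1ℚ :- q))) refl

  sumFin-cong : ∀ {n} {f g : Fin n → ℚ} → (∀ i → f i ≡ g i) → sumFin f ≡ sumFin g
  sumFin-cong {ℕ.zero} f≗g = refl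
  sumFin-cong {suc n}  f≗g = cong₂ _+_ (f≗g fzero) (sumFin-cong (f≗g ∘ fsuc))

  sumFin-distrib-+ : ∀ {n} (f g : Fin n → ℚ) → sumFin (λ i → f i + g i) ≡ sumFin f + sumFin g
  sumFin-distrib-+ {ℕ.zero} f g = refl
  sumFin-distrib-+ {suc n}  f g = begin-equality
    (f fzero + g fzero) + sumFin (λ i → f (fsuc i) + g (fsuc i))
      ≡⟨ cong (f fzero + g fzero +_) (sumFin-distrib-+ (f ∘ fsuc) (g ∘ fsuc)) ⟩
    (f fzero + g fzero) + (sumFin (f ∘ fsuc) + sumFin (g ∘ fsuc))
      ≡⟨ solve 4 (λ a b c d → (a :+ b) :+ (c :+ d) := (a :+ c) :+ (b :+ d)) refl
           (f fzero) (g fzero) (sumFin (f ∘ fsuc)) (sumFin (g ∘ fsuc)) ⟩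
    (f fzero + sumFin (f ∘ fsuc)) + (g fzero + sumFin (g ∘ fsuc)) ∎

  if-dec-elim : ∀ {A Q : Set} (P : A → Set) (Q? : Dec Q) {u v} → (Q → P u) → P v →
    P (if does Q? then u else v)
  if-dec-elim P (yes q) Pu _  = Pu q
  if-dec-elim P (no _)  _  Pv = Pv

  if-dec-yes : ∀ {A Q : Set} (Q? : Dec Q) {u v : A} → Q → (if does Q? then u else v) ≡ u
  if-dec-yes Q? {u} {v} q = cong (if_then u else v) (dec-true Q? q)

  if-dec-no : ∀ {A Q : Set} (Q? : Dec Q) {u v : A} → ¬ Q → (if does Q? then u else v) ≡ v
  if-dec-no Q? {u} {v} ¬q = cong (if_then u else v) (dec-false Q? ¬q)

  ≡-if-split : ∀ {P : Set} (P? : Dec P) {m p q : ℚ} → (P → m ≡ p) → (¬ P → m ≡ q) →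
    m ≡ (if does P? then p else 0ℚ) + (if does P? then 0ℚ else q)
  ≡-if-split (yes h) m≡p _ = trans (m≡p h) (sym (+-identityʳ _))
  ≡-if-split (no ¬h) _ m≡q = trans (m≡q ¬h) (sym (+-identityˡ _))

  module _ (I : MKInstance) where
    open MKInstance I

    Box : (ℕ → Fin n → ℚ) → Set
    Box x = ∀ t i → 1 ℕ.≤ t → t ℕ.≤ T → InUnitInterval (x t i)

    WithinCapacities : (ℕ → Fin n → ℚ) → Set
    WithinCapacities x = ∀ t → 1 ℕ.≤ t → t ℕ.≤ T → sumFin (λ i → w t i * x t i) ≤ C t

  step : ∀ {n} → (ℕ → Fin n → ℚ) → ℕ → Fin n → ℚ
  step x t i = x (suc t) i - x t i

  canonicalZ : ∀ {n} → (ℕ → Fin n → ℚ) → ℕ → Fin n → ℚ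
  canonicalZ x t i = 1ℚ - ∣ step x t i ∣

  canonicalZ-feasible : ∀ I {x} → Box I x → WithinCapacities I x → FeasibleLP I x (canonicalZ x)
  canonicalZ-feasible I {x} box cap = box , z-box , cap , z≤x-x′+1 , z≤x′-x+1
    where
    open MKInstance I

    z-box : ∀ t i → 1 ℕ.≤ t → t ℕ.< T → InUnitInterval (canonicalZ x t i)
    z-box t i 1≤t t<T =
      p≤q⇒0≤q-p (∣p-q∣≤1 (box (suc t) i (s≤s z≤n) t<T) (box t i 1≤t (ℕₚ.<⇒≤ t<T))) ,
      1-∣p∣≤1 (step x t i)

    z≤x-x′+1 : ∀ t i → 1 ℕ.≤ t → t ℕ.< T → canonicalZ x t i ≤ (- x (suc t) i) + x t i + 1ℚ
    z≤x-x′+1 t i _ _ = begin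
      1ℚ - ∣ step x t i ∣            ≤⟨ 1-∣p∣≤1-p (step x t i) ⟩
      1ℚ - (x (suc t) i - x t i)     ≡⟨ solve 2 (λ u v → con 1ℚ :- (v :- u) := (:- v) :+ u :+ con 1ℚ)
                                          refl (x t i) (x (suc t) i) ⟩
      (- x (suc t) i) + x t i + 1ℚ   ∎

    z≤x′-x+1 : ∀ t i → 1 ℕ.≤ t → t ℕ.< T → canonicalZ x t i ≤ x (suc t) i - x t i + 1ℚ
    z≤x′-x+1 t i _ _ = begin
      1ℚ - ∣ step x t i ∣            ≡⟨ cong (_-_ 1ℚ) (∣-p∣≡∣p∣ (step x t i)) ⟨
      1ℚ - ∣ - step x t i ∣          ≤⟨ 1-∣p∣≤1-p (- step x t i) ⟩
      1ℚ - (- (x (suc t) i - x t i)) ≡⟨ solve 2 (λ u v → con 1ℚ :- (:- (v :- u)) := v :- u :+ con 1ℚ)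
                                          refl (x t i) (x (suc t) i) ⟩
      x (suc t) i - x t i + 1ℚ       ∎

  module Window (I : MKInstance) (x : ℕ → Fin (MKInstance.n I) → ℚ)
    (box : Box I x) (cap : WithinCapacities I x)
    {t₀ t₁ : ℕ} (1≤t₀ : 1 ℕ.≤ t₀) (t₀≤t₁ : t₀ ℕ.≤ t₁) (t₁≤T : t₁ ℕ.≤ MKInstance.T I) where

    open MKInstance I
    open Sub I x t₀ t₁ public

    t₀≤T : t₀ ℕ.≤ T
    t₀≤T = ℕₚ.≤-trans t₀≤t₁ t₁≤T

    InWindow : ℕ → Set
    InWindow t = t₀ ℕ.≤ t × t ℕ.≤ t₁

    before-window : ∀ {t} → t ℕ.< t₀ → ¬ InWindow t
    before-window t<t₀ (t₀≤t , _) = ℕₚ.<⇒≱ t<t₀ t₀≤t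

    after-window : ∀ {t} → t₁ ℕ.< t → ¬ InWindow t
    after-window t₁<t (_ , t≤t₁) = ℕₚ.<⇒≱ t₁<t t≤t₁

    constant-on-window : ∀ {t i} → InF i → InWindow t → x t i ≡ ŷ i
    constant-on-window {t} {i} (_ , constant , _) (t₀≤t , t≤t₁) =
      subst (λ s → x s i ≡ x t₀ i) t₀+[t-t₀]≡t (constant (fromℕ< t-t₀<len))
      where
      t-t₀<len : t ∸ t₀ ℕ.< suc (t₁ ∸ t₀)
      t-t₀<len = s≤s (ℕₚ.∸-monoˡ-≤ t₀ t≤t₁)

      t₀+[t-t₀]≡t : t₀ ℕ.+ toℕ (fromℕ< t-t₀<len) ≡ t
      t₀+[t-t₀]≡t = trans (cong (t₀ ℕ.+_) (toℕ-fromℕ< t-t₀<len)) (ℕₚ.m+[n∸m]≡n t₀≤t)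

    constant-at-t₁ : ∀ {i} → InF i → x t₁ i ≡ ŷ i
    constant-at-t₁ i∈F = constant-on-window i∈F (t₀≤t₁ , ℕₚ.≤-refl)

    changes-on-entry : ∀ {i} → 1 ℕ.< t₀ → InF i → x (t₀ ∸ 1) i ≢ x t₀ i
    changes-on-entry 1<t₀ (_ , _ , inj₁ t₀≡1 , _) = contradiction t₀≡1 (ℕₚ.>⇒≢ 1<t₀)
    changes-on-entry 1<t₀ (_ , _ , inj₂ changes , _) = changes

    changes-on-exit : ∀ {i} → t₁ ℕ.< T → InF i → x (suc t₁) i ≢ x t₁ i
    changes-on-exit t₁<T (_ , _ , _ , inj₁ t₁≡T) = contradiction t₁≡T (ℕₚ.<⇒≢ t₁<T)
    changes-on-exit t₁<T (_ , _ , _ , inj₂ changes) = changes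

    entry-in-box : ∀ {i} → 1 ℕ.< t₀ → InUnitInterval (x (t₀ ∸ 1) i)
    entry-in-box 1<t₀ = box _ _ (ℕₚ.∸-monoˡ-≤ 1 1<t₀) (ℕₚ.≤-trans (ℕₚ.m∸n≤m t₀ 1) t₀≤T)

    entry-below? : ∀ i → Dec (1 ℕ.< t₀ × x (t₀ ∸ 1) i < x t₀ i)
    entry-below? i = 1 ℕ.<? t₀ ×-dec x (t₀ ∸ 1) i <? x t₀ i
    entry-above? : ∀ i → Dec (1 ℕ.< t₀ × x t₀ i < x (t₀ ∸ 1) i)
    entry-above? i = 1 ℕ.<? t₀ ×-dec x t₀ i <? x (t₀ ∸ 1) i

    exit-below? : ∀ i → Dec (t₁ ℕ.< T × x (suc t₁) i < x t₁ i)
    exit-below? i = t₁ ℕ.<? T ×-dec x (suc t₁) i <? x t₁ i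
    exit-above? : ∀ i → Dec (t₁ ℕ.< T × x t₁ i < x (suc t₁) i)
    exit-above? i = t₁ ℕ.<? T ×-dec x t₁ i <? x (suc t₁) i

    a₀ b₀ : Fin n → ℚ
    a₀ i = if does (entry-below? i) then x (t₀ ∸ 1) i else 0ℚ
    b₀ i = if does (entry-above? i) then x (t₀ ∸ 1) i else 1ℚ

    a₀≤a : ∀ i → a₀ i ≤ a i
    a₀≤a i = if-dec-elim (a₀ i ≤_) (exit-below? i) (λ _ → p≤p⊔q (a₀ i) (x (suc t₁) i)) ≤-refl

    b≤b₀ : ∀ i → b i ≤ b₀ i
    b≤b₀ i = if-dec-elim (_≤ b₀ i) (exit-above? i) (λ _ → p⊓q≤p (b₀ i) (x (suc t₁) i)) ≤-refl

    0≤a : ∀ i → 0ℚ ≤ a i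
    0≤a i = ≤-trans (if-dec-elim (0ℚ ≤_) (entry-below? i) (proj₁ ∘ entry-in-box ∘ proj₁) ≤-refl) (a₀≤a i)

    b≤1 : ∀ i → b i ≤ 1ℚ
    b≤1 i = ≤-trans (b≤b₀ i) (if-dec-elim (_≤ 1ℚ) (entry-above? i) (proj₂ ∘ entry-in-box ∘ proj₁) ≤-refl)

    a≤ŷ : ∀ {i} → InF i → a i ≤ ŷ i
    a≤ŷ {i} i∈F = if-dec-elim (_≤ ŷ i) (exit-below? i)
      (λ (_ , e<x) → ⊔-lub a₀≤ŷ (≤-trans (<⇒≤ e<x) (≤-reflexive (constant-at-t₁ i∈F))))
      a₀≤ŷ
      where
      a₀≤ŷ : a₀ i ≤ ŷ i
      a₀≤ŷ = if-dec-elim (_≤ ŷ i) (entry-below? i) (<⇒≤ ∘ proj₂) (<⇒≤ (proj₁ (proj₁ i∈F)))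

    ŷ≤b : ∀ {i} → InF i → ŷ i ≤ b i
    ŷ≤b {i} i∈F = if-dec-elim (ŷ i ≤_) (exit-above? i)
      (λ (_ , x<e) → ⊓-glb ŷ≤b₀ (≤-trans (≤-reflexive (sym (constant-at-t₁ i∈F))) (<⇒≤ x<e)))
      ŷ≤b₀
      where
      ŷ≤b₀ : ŷ i ≤ b₀ i
      ŷ≤b₀ = if-dec-elim (ŷ i ≤_) (entry-above? i) (<⇒≤ ∘ proj₂) (<⇒≤ (proj₂ (proj₁ i∈F)))

    entry≤a : ∀ {i} → 1 ℕ.< t₀ → x (t₀ ∸ 1) i < x t₀ i → x (t₀ ∸ 1) i ≤ a i
    entry≤a {i} 1<t₀ c<x = ≤-trans (≤-reflexive (sym (if-dec-yes (entry-below? i) (1<t₀ , c<x)))) (a₀≤a i)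

    b≤entry : ∀ {i} → 1 ℕ.< t₀ → x t₀ i < x (t₀ ∸ 1) i → b i ≤ x (t₀ ∸ 1) i
    b≤entry {i} 1<t₀ x<c = ≤-trans (b≤b₀ i) (≤-reflexive (if-dec-yes (entry-above? i) (1<t₀ , x<c)))

    exit≤a : ∀ {i} → t₁ ℕ.< T → x (suc t₁) i < x t₁ i → x (suc t₁) i ≤ a i
    exit≤a {i} t₁<T e<x = ≤-trans (p≤q⊔p (a₀ i) (x (suc t₁) i))
      (≤-reflexive (sym (if-dec-yes (exit-below? i) (t₁<T , e<x))))

    b≤exit : ∀ {i} → t₁ ℕ.< T → x t₁ i < x (suc t₁) i → b i ≤ x (suc t₁) i
    b≤exit {i} t₁<T x<e = ≤-trans (≤-reflexive (if-dec-yes (exit-above? i) (t₁<T , x<e)))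
      (p⊓q≤q (b₀ i) (x (suc t₁) i))

    entry-side : ∀ {y i} → InP y → InF i → 1 ℕ.< t₀ → OnSideOf (x t₀ i) (x (t₀ ∸ 1) i) (y i)
    entry-side {y} {i} (_ , a≤y≤b) i∈F 1<t₀ =
      (λ c<X → ≤-trans (entry≤a 1<t₀ c<X) (proj₁ (a≤y≤b i i∈F))) ,
      (λ X<c → ≤-trans (proj₂ (a≤y≤b i i∈F)) (b≤entry 1<t₀ X<c))

    exit-side : ∀ {y i} → InP y → InF i → t₁ ℕ.< T → OnSideOf (x t₁ i) (x (suc t₁) i) (y i)
    exit-side {y} {i} (_ , a≤y≤b) i∈F t₁<T =
      (λ e<X → ≤-trans (exit≤a t₁<T e<X) (proj₁ (a≤y≤b i i∈F))) ,
      (λ X<e → ≤-trans (proj₂ (a≤y≤b i i∈F)) (b≤exit t₁<T X<e))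

    load : (Fin n → ℚ) → ℕ → ℚ
    load y t = sumFin (λ i → if does (inF? i) then w t i * y i else 0ℚ)

    fixedLoad : ℕ → ℚ
    fixedLoad t = sumFin (λ i → if does (inF? i) then 0ℚ else w t i * x t i)

    load-split : ∀ {x′ : Fin n → ℚ} y t → (∀ i → InF i → x′ i ≡ y i) → (∀ i → ¬ InF i → x′ i ≡ x t i) →
      sumFin (λ i → w t i * x′ i) ≡ load y t + fixedLoad t
    load-split {x′} y t on-F off-F = begin-equality
      sumFin (λ i → w t i * x′ i)              ≡⟨ sumFin-cong split ⟩
      sumFin (λ i → free i + fixed i)          ≡⟨ sumFin-distrib-+ free fixed ⟩
      load y t + fixedLoad t                   ∎
      where
      free fixed : Fin n → ℚ
      free  i = if does (inF? i) then w t i * y i else 0ℚ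
      fixed i = if does (inF? i) then 0ℚ else w t i * x t i

      split : ∀ i → w t i * x′ i ≡ free i + fixed i
      split i = ≡-if-split (inF? i) (cong (w t i *_) ∘ on-F i) (cong (w t i *_) ∘ off-F i)

    ŷ∈P : InP ŷ
    ŷ∈P = capacity , λ i i∈F → a≤ŷ i∈F , ŷ≤b i∈F
      where
      capacity : ∀ t → t₀ ℕ.≤ t → t ℕ.≤ t₁ → load ŷ t ≤ C′ t
      capacity t t₀≤t t≤t₁ = p+r≤q⇒p≤q-r (subst (_≤ C t)
        (load-split ŷ t (λ i i∈F → constant-on-window i∈F (t₀≤t , t≤t₁)) (λ _ _ → refl))
        (cap t (ℕₚ.≤-trans 1≤t₀ t₀≤t) (ℕₚ.≤-trans t≤t₁ t₁≤T)))

    Lifted : ℕ → Fin n → Set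
    Lifted t i = InWindow t × InF i

    lifted? : ∀ t i → Dec (Lifted t i)
    lifted? t i = (t₀ ℕ.≤? t ×-dec t ℕ.≤? t₁) ×-dec inF? i

    lift : (Fin n → ℚ) → ℕ → Fin n → ℚ
    lift y t i = if does (lifted? t i) then y i else x t i

    lift-lifted : ∀ y {t i} → Lifted t i → lift y t i ≡ y i
    lift-lifted y {t} {i} = if-dec-yes (lifted? t i)

    lift-unlifted : ∀ y {t i} → ¬ Lifted t i → lift y t i ≡ x t i
    lift-unlifted y {t} {i} = if-dec-no (lifted? t i)

    lift-feasible : ∀ {y} → InP y → FeasibleLP I (lift y) (canonicalZ (lift y))
    lift-feasible {y} (load≤C′ , a≤y≤b) = canonicalZ-feasible I lift-box lift-capacity
      where
      lift-box : Box I (lift y)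
      lift-box t i 1≤t t≤T = if-dec-elim InUnitInterval (lifted? t i) y-box (box t i 1≤t t≤T)
        where
        y-box : Lifted t i → InUnitInterval (y i)
        y-box (_ , i∈F) with a≤y≤b i i∈F
        ... | a≤y , y≤b = ≤-trans (0≤a i) a≤y , ≤-trans y≤b (b≤1 i)

      lift-capacity : WithinCapacities I (lift y)
      lift-capacity t 1≤t t≤T with t₀ ℕ.≤? t ×-dec t ℕ.≤? t₁
      ... | yes in-window@(t₀≤t , t≤t₁) = subst (_≤ C t)
        (sym (load-split y t (λ i i∈F → lift-lifted y (in-window , i∈F))
                             (λ i i∉F → lift-unlifted y (i∉F ∘ proj₂))))
        (p≤q-r⇒p+r≤q (load≤C′ t t₀≤t t≤t₁))
      ... | no outside = subst (_≤ C t)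
        (sumFin-cong (λ i → cong (w t i *_) (sym (lift-unlifted y (outside ∘ proj₁)))))
        (cap t 1≤t t≤T)

    lift-midpoint : ∀ y₁ y₂ → (∀ i → InF i → ŷ i ≡ ½ * (y₁ i + y₂ i)) →
      ∀ t i → x t i ≡ ½ * (lift y₁ t i + lift y₂ t i)
    lift-midpoint y₁ y₂ mid t i with lifted? t i
    ... | yes l@(in-window , i∈F) = begin-equality
      x t i                        ≡⟨ constant-on-window i∈F in-window ⟩
      ŷ i                          ≡⟨ mid i i∈F ⟩
      ½ * (y₁ i + y₂ i)            ≡⟨ cong₂ (λ u v → ½ * (u + v)) (lift-lifted y₁ l) (lift-lifted y₂ l) ⟨
      ½ * (lift y₁ t i + lift y₂ t i) ∎
    ... | no ¬l = begin-equality
      x t i                        ≡⟨ ½*[p+p]≡p (x t i) ⟨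
      ½ * (x t i + x t i)          ≡⟨ cong₂ (λ u v → ½ * (u + v)) (lift-unlifted y₁ ¬l) (lift-unlifted y₂ ¬l) ⟨
      ½ * (lift y₁ t i + lift y₂ t i) ∎

    step-unlifted : ∀ y {t i} → ¬ Lifted t i → ¬ Lifted (suc t) i → step (lift y) t i ≡ step x t i
    step-unlifted y ¬l ¬l′ = cong₂ _-_ (lift-unlifted y ¬l′) (lift-unlifted y ¬l)

    step-entering : ∀ y {t i} → suc t ≡ t₀ → InF i → step (lift y) t i ≡ y i - x (t₀ ∸ 1) i
    step-entering y {t} {i} t+1≡t₀ i∈F = cong₂ _-_
      (lift-lifted y ((ℕₚ.≤-reflexive (sym t+1≡t₀) , subst (ℕ._≤ t₁) (sym t+1≡t₀) t₀≤t₁) , i∈F))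
      (trans (lift-unlifted y (before-window (subst (t ℕ.<_) t+1≡t₀ (ℕₚ.n<1+n t)) ∘ proj₁))
             (cong (λ s → x (s ∸ 1) i) t+1≡t₀))

    step-inside : ∀ y {t i} → InWindow t → InWindow (suc t) → InF i → step (lift y) t i ≡ 0ℚ
    step-inside y {t} {i} in-window in-window′ i∈F = begin-equality
      lift y (suc t) i - lift y t i ≡⟨ cong₂ _-_ (lift-lifted y (in-window′ , i∈F))
                                                 (lift-lifted y (in-window , i∈F)) ⟩
      y i - y i                     ≡⟨ +-inverseʳ (y i) ⟩
      0ℚ                            ∎

    step-leaving : ∀ y {i} → InF i → step (lift y) t₁ i ≡ x (suc t₁) i - y i
    step-leaving y i∈F = cong₂ _-_
      (lift-unlifted y (after-window (ℕₚ.n<1+n t₁) ∘ proj₁))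
      (lift-lifted y ((t₀≤t₁ , ℕₚ.≤-refl) , i∈F))

    module _ {y₁ y₂ : Fin n → ℚ} (y₁∈P : InP y₁) (y₂∈P : InP y₂) where

      sameSide-steps-by : ∀ {t i} (d : (Fin n → ℚ) → ℚ) → (∀ y → step (lift y) t i ≡ d y) →
        SameSide 0ℚ (d y₁) (d y₂) → SameSide 0ℚ (step (lift y₁) t i) (step (lift y₂) t i)
      sameSide-steps-by d step≡d = subst₂ (SameSide 0ℚ) (sym (step≡d y₁)) (sym (step≡d y₂))

      lift-steps-sameSide : ∀ t i → 1 ℕ.≤ t → t ℕ.< T →
        SameSide 0ℚ (step (lift y₁) t i) (step (lift y₂) t i)
      lift-steps-sameSide t i 1≤t t<T with inF? i
      ... | no i∉F = sameSide-steps-by (λ _ → step x t i)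
        (λ y → step-unlifted y (i∉F ∘ proj₂) (i∉F ∘ proj₂)) (sameSide-refl 0ℚ _)
      ... | yes i∈F with ℕₚ.<-cmp (suc t) t₀
      ...   | tri< t+1<t₀ _ _ = sameSide-steps-by (λ _ → step x t i)
        (λ y → step-unlifted y (before-window (ℕₚ.<-trans (ℕₚ.n<1+n t) t+1<t₀) ∘ proj₁)
                             (before-window t+1<t₀ ∘ proj₁))
        (sameSide-refl 0ℚ _)
      ...   | tri≈ _ t+1≡t₀ _ = sameSide-steps-by (λ y → y i - x (t₀ ∸ 1) i)
        (λ y → step-entering y t+1≡t₀ i∈F)
        (sameSide-subʳ (onSideOf⇒sameSide (changes-on-entry 1<t₀ i∈F)
          (entry-side y₁∈P i∈F 1<t₀) (entry-side y₂∈P i∈F 1<t₀)))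
        where
        1<t₀ : 1 ℕ.< t₀
        1<t₀ = subst (1 ℕ.<_) t+1≡t₀ (s≤s 1≤t)
      ...   | tri> _ _ t₀<t+1 with ℕₚ.<-cmp t t₁
      ...     | tri< t<t₁ _ _ = sameSide-steps-by (λ _ → 0ℚ)
        (λ y → step-inside y (ℕₚ.≤-pred t₀<t+1 , ℕₚ.<⇒≤ t<t₁) (ℕₚ.<⇒≤ t₀<t+1 , t<t₁) i∈F)
        (sameSide-refl 0ℚ 0ℚ)
      ...     | tri≈ _ refl _ = sameSide-steps-by (λ y → x (suc t₁) i - y i)
        (λ y → step-leaving y i∈F)
        (sameSide-subˡ (onSideOf⇒sameSide (changes-on-exit t<T i∈F)
          (exit-side y₁∈P i∈F t<T) (exit-side y₂∈P i∈F t<T)))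
      ...     | tri> _ _ t₁<t = sameSide-steps-by (λ _ → step x t i)
        (λ y → step-unlifted y (after-window t₁<t ∘ proj₁)
                             (after-window (ℕₚ.m<n⇒m<1+n t₁<t) ∘ proj₁))
        (sameSide-refl 0ℚ _)

      lift-isMidpoint : (∀ i → InF i → ŷ i ≡ ½ * (y₁ i + y₂ i)) →
        IsMidpoint I x (canonicalZ x) (lift y₁) (canonicalZ (lift y₁)) (lift y₂) (canonicalZ (lift y₂))
      lift-isMidpoint mid = (λ t i _ _ → lift-midpoint y₁ y₂ mid t i) , z-midpoint
        where
        z-midpoint : ∀ t i → 1 ℕ.≤ t → t ℕ.< T →
          canonicalZ x t i ≡ ½ * (canonicalZ (lift y₁) t i + canonicalZ (lift y₂) t i)
        z-midpoint t i 1≤t t<T =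
          1-∣v-u∣-midpoint {u₁ = lift y₁ t i} {lift y₂ t i} {v₁ = lift y₁ (suc t) i} {lift y₂ (suc t) i}
            (lift-midpoint y₁ y₂ mid t i) (lift-midpoint y₁ y₂ mid (suc t) i) (lift-steps-sameSide t i 1≤t t<T)

open import Data.Nat using (_≤_; _<_)

lemma1 : (I : MKInstance) → (x z : ℕ → Fin (MKInstance.n I) → ℚ) →
    FeasibleLP I x z →
    (∀ t i → 1 ≤ t → t < MKInstance.T I → z t i ≡ 1ℚ - ∣ x (suc t) i - x t i ∣) →
    (t₀ t₁ : ℕ) → 1 ≤ t₀ → t₀ ≤ t₁ → t₁ ≤ MKInstance.T I →
    BasicLP I x z →
    Sub.InP I x t₀ t₁ (Sub.ŷ I x t₀ t₁) × Sub.VertexP I x t₀ t₁ (Sub.ŷ I x t₀ t₁)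
lemma1 I x z (box , _ , cap , _) z≡ t₀ t₁ 1≤t₀ t₀≤t₁ t₁≤T (_ , extreme) = ŷ∈P , ŷ∈P , ŷ-extreme
  where
  open Window I x box cap 1≤t₀ t₀≤t₁ t₁≤T

  ŷ-extreme : ∀ y₁ y₂ → InP y₁ → InP y₂ → (∀ i → InF i → ŷ i ≡ ½ * (y₁ i + y₂ i)) →
    ∀ i → InF i → y₁ i ≡ y₂ i
  ŷ-extreme y₁ y₂ y₁∈P y₂∈P mid i i∈F = begin
    y₁ i         ≡⟨ lift-lifted y₁ start ⟨
    lift y₁ t₀ i ≡⟨ proj₁ lifts-agree t₀ i 1≤t₀ t₀≤T ⟩
    lift y₂ t₀ i ≡⟨ lift-lifted y₂ start ⟩
    y₂ i         ∎
    where
    open ≡-Reasoning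

    start : Lifted t₀ i
    start = (ℕₚ.≤-refl , t₀≤t₁) , i∈F

    lifts-agree : SameSol I (lift y₁) (canonicalZ (lift y₁)) (lift y₂) (canonicalZ (lift y₂))
    lifts-agree with lift-isMidpoint y₁∈P y₂∈P mid
    ... | x-mid , z-mid = extreme _ _ _ _ (lift-feasible y₁∈P) (lift-feasible y₂∈P)
      (x-mid , λ t i 1≤t t<T → trans (z≡ t i 1≤t t<T) (z-mid t i 1≤t t<T))
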